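{- Let $q$ be a prime power, $n$ a positive integer coprime to $q$, $\gamma\in\mathbb{Z}/n\mathbb{Z}$, $\omega_\gamma$ as in the context, and let $E$ be an equal-difference subset of $c_{n/q}(\gamma)$. Then $E$ is contained in one of the subsets $c_{n/q^{\omega_\gamma}}(\gamma q^j)$, $j=0,1,\dots,\omega_\gamma-1$.
   Context: For $N$ coprime to $n$, $c_{n/N}(\beta)=\{\beta,\beta N,\dots,\beta N^{\sigma-1}\}\subseteq\mathbb{Z}/n\mathbb{Z}$ with $\sigma$ least positive such that $\beta N^\sigma\equiv\beta\pmod n$. A subset $E\subseteq c_{n/q}(\gamma)$ with $|E|=\tau_E$ is an equal-difference subset if $\tau_E\mid n$ and $E=\{e,e+\frac n{\tau_E},\dots,e+(\tau_E-1)\frac n{\tau_E}\}$ in $\mathbb{Z}/n\mathbb{Z}$ for some $e\in E$. With $n_\gamma=n/\gcd(\gamma,n)$, $\mathrm{rad}(m)$ the product of distinct primes dividing $m$, $\mathrm{ord}_m(q)$ the order of $q$ mod $m$: $\omega_\gamma=2\,\mathrm{ord}_{\mathrm{rad}(n_\gamma)}(q)$ if $q^{\mathrm{ord}_{\mathrm{rad}(n_\gamma)}(q)}\equiv3\pmod4$ and $8\mid n_\gamma$, and $\omega_\gamma=\mathrm{ord}_{\mathrm{rad}(n_\gamma)}(q)$ otherwise. -}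

module Defs where

open import Data.Nat using (ℕ; zero; suc; _+_; _*_; _^_; _<_; _%_; _≟_; NonZero)
open import Data.Nat.Divisibility using (_∣_; _∣?_; quotient)
open import Data.Nat.GCD using (gcd; gcd[m,n]∣n)
open import Data.Nat.Primality using (Prime; prime?)
open import Data.Nat.Coprimality using (Coprime)
open import Data.Fin using (Fin; toℕ)
open import Data.Fin.Subset using (Subset; _∈_; ∣_∣)
open import Data.List using (List; filter; upTo)
open import Data.Nat.ListAction using (product)
open import Data.Bool using (if_then_else_; _∧_)
open import Data.Product using (Σ; ∃; ∃-syntax; _×_)
open import Data.Sum using (_⊎_)
open import Relation.Nullary using (¬_; Dec; yes; no; does)
open import Relation.Nullary.Decidable using (_×-dec_)
open import Relation.Binary.PropositionalEquality using (_≡_)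

infix 4 _≡_[mod_]
_≡_[mod_] : ℕ → ℕ → ℕ → Set
a ≡ b [mod m ] = ∃[ k ] (a + k * m ≡ b ⊎ b + k * m ≡ a)

IsPrimePower : ℕ → Set
IsPrimePower q = ∃[ p ] ∃[ k ] (Prime p × 0 < k × q ≡ p ^ k)

-- Z/nZ is represented by Fin n (residues 0..n-1).
-- Membership in the cyclotomic coset c_{n/N}(β) = {β, βN, ..., βN^{σ-1}}
-- (β given by a natural-number representative).  Since βN^i is periodic in i
-- with period σ, this set equals {βN^i mod n : i ∈ ℕ}.
InCoset : (n N β : ℕ) → Fin n → Set
InCoset n N β x = ∃[ i ] (toℕ x ≡ β * N ^ i [mod n ])

SubsetOfCoset : (n N β : ℕ) → Subset n → Set
SubsetOfCoset n N β E = ∀ x → x ∈ E → InCoset n N β x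

-- E is an equal-difference subset: with τ = |E|, τ ∣ n and
-- E = {e, e + n/τ, ..., e + (τ-1) n/τ} in Z/nZ for some e ∈ E.
-- (n/τ is written as the quotient d with n = d * τ.)
EqualDifference : (n : ℕ) → Subset n → Set
EqualDifference n E =
  ∃[ d ] (n ≡ d * ∣ E ∣ ×
    ∃[ e ] (e ∈ E ×
      ∀ x → ((x ∈ E → ∃[ k ] (k < ∣ E ∣ × toℕ x ≡ toℕ e + k * d [mod n ])) ×
             ((∃[ k ] (k < ∣ E ∣ × toℕ x ≡ toℕ e + k * d [mod n ])) → x ∈ E))))

nγ : ℕ → ℕ → ℕ
nγ n g = quotient (gcd[m,n]∣n g n)

rad : ℕ → ℕ
rad m = product (filter (λ p → prime? p ×-dec (p ∣? m)) (upTo (suc m)))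

IsOrder : (m q o : ℕ) → Set
IsOrder m q o = 0 < o × (q ^ o ≡ 1 [mod m ]) ×
  (∀ j → 0 < j → j < o → ¬ (q ^ j ≡ 1 [mod m ]))

-- ω_γ, given o = ord_{rad(n_γ)}(q) and the value N = n_γ
omega : (q o N : ℕ) → ℕ
omega q o N = if does ((q ^ o % 4) ≟ 3) ∧ does (8 ∣? N) then 2 * o else o

{-# OPTIONS --safe #-}
-- Let e ≡ γ q^b be the base point of E, d = n / |E| its common difference and
-- g = gcd(γ, n).  Every term γ q^b + k d (k < |E|) lies in γ⟨q⟩, so after dividing
-- by g the terms γ′ q^b + k d′ form an arithmetic progression of units modulo
-- N = n_γ = d′ |E|.  A prime p ∣ N with p ∤ d′ divides |E| and then one of the first
-- p terms, so rad N ∣ d′; and if 8 ∣ N then 4 ∣ d′, since modulo 8 the powers of the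
-- odd q take only two values while three consecutive terms are pairwise incongruent
-- unless 4 ∣ d′.  Consequently q^c ≡ 1 (mod d′) forces o ∣ c, and in the exceptional
-- case (q^o ≡ 3 (mod 4), 8 ∣ N) also 2o ∣ c; that is, ω_γ ∣ c.  Any two elements
-- γ q^a, γ q^b of E agree modulo d, hence q^(a-b) ≡ 1 (mod d′) and a ≡ b (mod ω_γ).
module Submission where

open import Defs
open import Data.Nat using (ℕ; _*_; _^_; _<_; NonZero)
open import Data.Nat.Coprimality using (Coprime)
open import Data.Fin using (Fin; toℕ)
open import Data.Fin.Subset using (Subset; _∈_)
open import Data.Product using (∃-syntax; _×_)

open import Data.Bool using (if_then_else_; _∧_)
open import Data.Fin using (fromℕ<)
open import Data.Fin.Properties using (toℕ-fromℕ<)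
open import Data.Fin.Subset using (∣_∣)
open import Data.Integer.Base as ℤ using (+_; -[1+_])
import Data.Integer.Coprimality as ℤ using (coprime-divisor)
import Data.Integer.Divisibility.Signed as ℤ
import Data.Integer.Properties as ℤ
import Data.Integer.Tactic.RingSolver as ℤ using (solve-∀)
open import Data.List using ([]; _∷_; upTo)
open import Data.List.Relation.Unary.All as All using (All; []; _∷_)
open import Data.List.Relation.Unary.All.Properties using (All¬⇒¬Any; all-filter)
open import Data.List.Relation.Unary.Unique.Propositional using (Unique; []; _∷_)
import Data.List.Relation.Unary.Unique.Propositional.Properties as Unique
open import Data.Nat
open import Data.Nat.Coprimality as Coprime
  using (coprime-divisor; coprime-Bézout; coprime-/gcd; 1-coprimeTo)
open import Data.Nat.Divisibility
open import Data.Nat.DivMod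
open import Data.Nat.GCD using (gcd; gcd[m,n]∣m; gcd[m,n]∣n; module Bézout)
open import Data.Nat.ListAction using (product)
open import Data.Nat.Primality
  using (Prime; prime?; prime⇒irreducible; prime⇒nonZero; euclidsLemma; ¬prime[1])
open import Data.Nat.Primality.Factorisation using (factorisationHasAllPrimeFactors)
open import Data.Nat.Properties
open import Data.Nat.Tactic.RingSolver using (solve-∀)
open import Data.Product using (_,_; proj₁; proj₂)
open import Data.Sum using (_⊎_; inj₁; inj₂)
open import Function using (_∘_)
open import Level using (0ℓ)
open import Relation.Binary.Bundles using (Setoid)
open import Relation.Binary.PropositionalEquality
import Relation.Binary.Reasoning.Setoid as SetoidReasoning
open import Relation.Binary.Structures using (IsEquivalence)
open import Relation.Nullary using (¬_; Dec; does; yes; no; contradiction)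
open import Relation.Nullary.Decidable using (_×-dec_; from-no)
open import Relation.Unary using (Decidable)

-- Congruences

pos-∣ : ∀ {k x} → k ∣ x → + k ℤ.∣ + x
pos-∣ {k} {x} = ℤ.∣ᵤ⇒∣ {+ k} {+ x}

pos-∣⁻¹ : ∀ {k x} → + k ℤ.∣ + x → k ∣ x
pos-∣⁻¹ = ℤ.∣⇒∣ᵤ

private
  a+x-a≡x : ∀ a x → a ℤ.+ x ℤ.- a ≡ x
  a+x-a≡x = ℤ.solve-∀

  a-[a-b]≡b : ∀ a b → a ℤ.- (a ℤ.- b) ≡ b
  a-[a-b]≡b = ℤ.solve-∀

-- Integer divisibility of a - b, so that cancellation is available; equivalent to
-- _≡_[mod_] of Defs, and a record so that a, b and m can be inferred.
infix 4 _≈_[mod_]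
record _≈_[mod_] (a b m : ℕ) : Set where
  constructor congruent
  field m∣a-b : + m ℤ.∣ + a ℤ.- + b

module _ {m : ℕ} where

  ≈-refl : ∀ {a} → a ≈ a [mod m ]
  ≈-refl {a} = congruent (ℤ.divides (+ 0) (ℤ.+-inverseʳ (+ a)))

  ≈-sym : ∀ {a b} → a ≈ b [mod m ] → b ≈ a [mod m ]
  ≈-sym {a} {b} (congruent m∣a-b) =
    congruent (subst (_ ℤ.∣_) (-[a-b]≡b-a (+ a) (+ b)) (ℤ.∣m⇒∣-m m∣a-b))
    where
    -[a-b]≡b-a : ∀ a b → ℤ.- (a ℤ.- b) ≡ b ℤ.- a
    -[a-b]≡b-a = ℤ.solve-∀

  ≈-trans : ∀ {a b c} → a ≈ b [mod m ] → b ≈ c [mod m ] → a ≈ c [mod m ]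
  ≈-trans {a} {b} {c} (congruent m∣a-b) (congruent m∣b-c) =
    congruent (subst (_ ℤ.∣_) ([a-b]+[b-c]≡a-c (+ a) (+ b) (+ c)) (ℤ.∣m∣n⇒∣m+n m∣a-b m∣b-c))
    where
    [a-b]+[b-c]≡a-c : ∀ a b c → (a ℤ.- b) ℤ.+ (b ℤ.- c) ≡ a ℤ.- c
    [a-b]+[b-c]≡a-c = ℤ.solve-∀

  ≈-isEquivalence : IsEquivalence (_≈_[mod m ])
  ≈-isEquivalence = record { refl = ≈-refl ; sym = ≈-sym ; trans = ≈-trans }

  ≈-+ : ∀ {a b c d} → a ≈ b [mod m ] → c ≈ d [mod m ] → a + c ≈ b + d [mod m ]
  ≈-+ {a} {b} {c} {d} (congruent m∣a-b) (congruent m∣c-d) =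
    congruent (subst (_ ℤ.∣_) difference (ℤ.∣m∣n⇒∣m+n m∣a-b m∣c-d))
    where
    [a-b]+[c-d]≡[a+c]-[b+d] : ∀ a b c d → (a ℤ.- b) ℤ.+ (c ℤ.- d) ≡ (a ℤ.+ c) ℤ.- (b ℤ.+ d)
    [a-b]+[c-d]≡[a+c]-[b+d] = ℤ.solve-∀
    difference : (+ a ℤ.- + b) ℤ.+ (+ c ℤ.- + d) ≡ + (a + c) ℤ.- + (b + d)
    difference = trans ([a-b]+[c-d]≡[a+c]-[b+d] (+ a) (+ b) (+ c) (+ d))
                       (sym (cong₂ ℤ._-_ (ℤ.pos-+ a c) (ℤ.pos-+ b d)))

  ≈-* : ∀ {a b c d} → a ≈ b [mod m ] → c ≈ d [mod m ] → a * c ≈ b * d [mod m ]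
  ≈-* {a} {b} {c} {d} (congruent m∣a-b) (congruent m∣c-d) =
    congruent (subst (_ ℤ.∣_) difference
      (ℤ.∣m∣n⇒∣m+n (ℤ.∣m⇒∣m*n (+ c) m∣a-b) (ℤ.∣n⇒∣m*n (+ b) m∣c-d)))
    where
    [a-b]c+b[c-d]≡ac-bd : ∀ a b c d → (a ℤ.- b) ℤ.* c ℤ.+ b ℤ.* (c ℤ.- d) ≡ a ℤ.* c ℤ.- b ℤ.* d
    [a-b]c+b[c-d]≡ac-bd = ℤ.solve-∀
    difference : (+ a ℤ.- + b) ℤ.* + c ℤ.+ + b ℤ.* (+ c ℤ.- + d) ≡ + (a * c) ℤ.- + (b * d)
    difference = trans ([a-b]c+b[c-d]≡ac-bd (+ a) (+ b) (+ c) (+ d))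
                       (sym (cong₂ ℤ._-_ (ℤ.pos-* a c) (ℤ.pos-* b d)))

  ≈-+ˡ : ∀ c {a b} → a ≈ b [mod m ] → c + a ≈ c + b [mod m ]
  ≈-+ˡ c = ≈-+ (≈-refl {c})

  ≈-+ʳ : ∀ c {a b} → a ≈ b [mod m ] → a + c ≈ b + c [mod m ]
  ≈-+ʳ c a≈b = ≈-+ a≈b (≈-refl {c})

  ≈-*ˡ : ∀ c {a b} → a ≈ b [mod m ] → c * a ≈ c * b [mod m ]
  ≈-*ˡ c = ≈-* (≈-refl {c})

  ≈-*ʳ : ∀ c {a b} → a ≈ b [mod m ] → a * c ≈ b * c [mod m ]
  ≈-*ʳ c a≈b = ≈-* a≈b (≈-refl {c})

  ≈-^ : ∀ {a b} k → a ≈ b [mod m ] → a ^ k ≈ b ^ k [mod m ]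
  ≈-^ zero    a≈b = ≈-refl
  ≈-^ (suc k) a≈b = ≈-* a≈b (≈-^ k a≈b)

  +-*-≈ : ∀ a k → a + k * m ≈ a [mod m ]
  +-*-≈ a k = congruent (ℤ.divides (+ k) (begin
    + (a + k * m) ℤ.- + a      ≡⟨ cong (ℤ._- + a) (ℤ.pos-+ a (k * m)) ⟩
    + a ℤ.+ + (k * m) ℤ.- + a  ≡⟨ a+x-a≡x (+ a) (+ (k * m)) ⟩
    + (k * m)                  ≡⟨ ℤ.pos-* k m ⟩
    + k ℤ.* + m                ∎))
    where open ≡-Reasoning

  *-≈0 : ∀ k → k * m ≈ 0 [mod m ]
  *-≈0 = +-*-≈ 0

  %-≈ : ∀ a .{{_ : NonZero m}} → a % m ≈ a [mod m ]
  %-≈ a = ≈-sym (subst (_≈ a % m [mod m ]) (sym (m≡m%n+[m/n]*n a m)) (+-*-≈ (a % m) (a / m)))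

  +-≈⇒∣ : ∀ {a x} → a + x ≈ a [mod m ] → m ∣ x
  +-≈⇒∣ {a} {x} (congruent m∣a+x-a) = pos-∣⁻¹ (subst (_ ℤ.∣_) difference m∣a+x-a)
    where
    difference : + (a + x) ℤ.- + a ≡ + x
    difference = trans (cong (ℤ._- + a) (ℤ.pos-+ a x)) (a+x-a≡x (+ a) (+ x))

  ≈0⇒∣ : ∀ {x} → x ≈ 0 [mod m ] → m ∣ x
  ≈0⇒∣ = +-≈⇒∣ {0}

  ∣-resp-≈ : ∀ {k a b} → k ∣ m → a ≈ b [mod m ] → k ∣ a → k ∣ b
  ∣-resp-≈ {k} {a} {b} k∣m (congruent m∣a-b) k∣a = pos-∣⁻¹ (subst (_ ℤ.∣_) (a-[a-b]≡b (+ a) (+ b))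
    (ℤ.∣m∣n⇒∣m-n (pos-∣ k∣a) (ℤ.∣-trans (pos-∣ k∣m) m∣a-b)))

  coprime-cancelˡ-≈ : ∀ {c a b} → Coprime m c → c * a ≈ c * b [mod m ] → a ≈ b [mod m ]
  coprime-cancelˡ-≈ {c} {a} {b} m⊥c (congruent m∣ca-cb) = congruent (ℤ.∣ᵤ⇒∣
    (ℤ.coprime-divisor (+ m) (+ c) (+ a ℤ.- + b) m⊥c (ℤ.∣⇒∣ᵤ (subst (_ ℤ.∣_) difference m∣ca-cb))))
    where
    ca-cb≡c[a-b] : ∀ a b c → c ℤ.* a ℤ.- c ℤ.* b ≡ c ℤ.* (a ℤ.- b)
    ca-cb≡c[a-b] = ℤ.solve-∀
    difference : + (c * a) ℤ.- + (c * b) ≡ + c ℤ.* (+ a ℤ.- + b)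
    difference = trans (cong₂ ℤ._-_ (ℤ.pos-* c a) (ℤ.pos-* c b)) (ca-cb≡c[a-b] (+ a) (+ b) (+ c))

  *-cancelʳ-≈ : ∀ {g a b} .{{_ : NonZero g}} → a * g ≈ b * g [mod m * g ] → a ≈ b [mod m ]
  *-cancelʳ-≈ {g} {a} {b} (congruent mg∣ag-bg) = congruent (ℤ.*-cancelʳ-∣ (+ g)
    (subst₂ ℤ._∣_ (ℤ.pos-* m g) difference mg∣ag-bg))
    where
    ag-bg≡[a-b]g : ∀ a b g → a ℤ.* g ℤ.- b ℤ.* g ≡ (a ℤ.- b) ℤ.* g
    ag-bg≡[a-b]g = ℤ.solve-∀
    difference : + (a * g) ℤ.- + (b * g) ≡ (+ a ℤ.- + b) ℤ.* + g
    difference = trans (cong₂ ℤ._-_ (ℤ.pos-* a g) (ℤ.pos-* b g)) (ag-bg≡[a-b]g (+ a) (+ b) (+ g))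

≈-setoid : ℕ → Setoid 0ℓ 0ℓ
≈-setoid m = record { isEquivalence = ≈-isEquivalence {m} }

module ≈-Reasoning {m : ℕ} = SetoidReasoning (≈-setoid m)

≈-mod-∣ : ∀ {k m a b} → k ∣ m → a ≈ b [mod m ] → a ≈ b [mod k ]
≈-mod-∣ k∣m (congruent m∣a-b) = congruent (ℤ.∣-trans (pos-∣ k∣m) m∣a-b)

≡[mod]⇒≈ : ∀ {m a b} → a ≡ b [mod m ] → a ≈ b [mod m ]
≡[mod]⇒≈ {m} {a} {b} (k , inj₁ a+km≡b) = ≈-sym (subst (_≈ a [mod m ]) a+km≡b (+-*-≈ a k))
≡[mod]⇒≈ {m} {a} {b} (k , inj₂ b+km≡a) = subst (_≈ b [mod m ]) b+km≡a (+-*-≈ b k)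

≈⇒≡[mod] : ∀ {m a b} → a ≈ b [mod m ] → a ≡ b [mod m ]
≈⇒≡[mod] {m} {a} {b} (congruent (ℤ.divides (+ k) a-b≡km)) = k , inj₂ (ℤ.+-injective (begin
  + (b + k * m)          ≡⟨ ℤ.pos-+ b (k * m) ⟩
  + b ℤ.+ + (k * m)      ≡⟨ cong (λ x → + b ℤ.+ x) (ℤ.pos-* k m) ⟩
  + b ℤ.+ + k ℤ.* + m    ≡⟨ cong (λ x → + b ℤ.+ x) a-b≡km ⟨
  + b ℤ.+ (+ a ℤ.- + b)  ≡⟨ b+[a-b]≡a (+ a) (+ b) ⟩
  + a                    ∎))
  where
  open ≡-Reasoning
  b+[a-b]≡a : ∀ a b → b ℤ.+ (a ℤ.- b) ≡ a
  b+[a-b]≡a = ℤ.solve-∀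
≈⇒≡[mod] {m} {a} {b} (congruent (ℤ.divides -[1+ k ] a-b≡-km)) = suc k , inj₁ (ℤ.+-injective (begin
  + (a + suc k * m)                  ≡⟨ ℤ.pos-+ a (suc k * m) ⟩
  + a ℤ.+ + (suc k * m)              ≡⟨ cong (λ x → + a ℤ.+ x) (ℤ.pos-* (suc k) m) ⟩
  + a ℤ.+ + suc k ℤ.* + m            ≡⟨ a+sm≡a-[-s]m (+ a) (+ suc k) (+ m) ⟩
  + a ℤ.- -[1+ k ] ℤ.* + m           ≡⟨ cong (λ x → + a ℤ.- x) a-b≡-km ⟨
  + a ℤ.- (+ a ℤ.- + b)              ≡⟨ a-[a-b]≡b (+ a) (+ b) ⟩
  + b                                ∎))
  where
  open ≡-Reasoning
  a+sm≡a-[-s]m : ∀ a s m → a ℤ.+ s ℤ.* m ≡ a ℤ.- (ℤ.- s) ℤ.* m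
  a+sm≡a-[-s]m = ℤ.solve-∀

-- Coprimality and radicals

coprime-∣ˡ : ∀ {k m x} → k ∣ m → Coprime m x → Coprime k x
coprime-∣ˡ k∣m m⊥x (i∣k , i∣x) = m⊥x (∣-trans i∣k k∣m , i∣x)

coprime-*ʳ : ∀ {m a b} → Coprime m a → Coprime m b → Coprime m (a * b)
coprime-*ʳ {m} {a} {b} m⊥a m⊥b {i} (i∣m , i∣ab) = m⊥b (i∣m , coprime-divisor i⊥a i∣ab)
  where
  i⊥a : Coprime i a
  i⊥a (j∣i , j∣a) = m⊥a (∣-trans j∣i i∣m , j∣a)

coprime-^ʳ : ∀ {m a} k → Coprime m a → Coprime m (a ^ k)
coprime-^ʳ zero    m⊥a = Coprime.sym (1-coprimeTo _)
coprime-^ʳ (suc k) m⊥a = coprime-*ʳ m⊥a (coprime-^ʳ k m⊥a)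

coprime-resp-≈ : ∀ {m a b} → a ≈ b [mod m ] → Coprime m a → Coprime m b
coprime-resp-≈ a≈b m⊥a (i∣m , i∣b) = m⊥a (i∣m , ∣-resp-≈ i∣m (≈-sym a≈b) i∣b)

prime∤⇒coprime : ∀ {p n} → Prime p → ¬ p ∣ n → Coprime p n
prime∤⇒coprime p-prime p∤n (i∣p , i∣n) with prime⇒irreducible p-prime i∣p
... | inj₁ i≡1 = i≡1
... | inj₂ refl = contradiction i∣n p∤n

distinct-primes-product-∣ : ∀ {m ps} → All (λ p → Prime p × p ∣ m) ps → Unique ps →
  product ps ∣ m
distinct-primes-product-∣ {m} [] [] = 1∣ m
distinct-primes-product-∣ {m} {p ∷ ps} ((p-prime , p∣m) ∷ ps∣m) (p∉ps ∷ unique)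
  with distinct-primes-product-∣ ps∣m unique
... | divides r m≡rP = divides (quotient p∣r) (begin
  m                      ≡⟨ m≡rP ⟩
  r * P                  ≡⟨ cong (_* P) (m∣n⇒n≡quotient*m p∣r) ⟩
  quotient p∣r * p * P   ≡⟨ *-assoc (quotient p∣r) p P ⟩
  quotient p∣r * (p * P) ∎)
  where
  open ≡-Reasoning
  P : ℕ
  P = product ps
  p∤P : ¬ p ∣ P
  p∤P p∣P = All¬⇒¬Any p∉ps (factorisationHasAllPrimeFactors p-prime p∣P (All.map proj₁ ps∣m))
  p∣r : p ∣ r
  p∣r = coprime-divisor (prime∤⇒coprime p-prime p∤P) (subst (p ∣_) (trans m≡rP (*-comm r P)) p∣m)

rad-∣ : ∀ {N m} → (∀ {p} → Prime p → p ∣ N → p ∣ m) → rad N ∣ m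
rad-∣ {N} prime∣m = distinct-primes-product-∣
  (All.map (λ (p-prime , p∣N) → p-prime , prime∣m p-prime p∣N) (all-filter prime∣N? (upTo (suc N))))
  (Unique.filter⁺ prime∣N? (Unique.upTo⁺ (suc N)))
  where
  prime∣N? : Decidable (λ p → Prime p × p ∣ N)
  prime∣N? p = prime? p ×-dec (p ∣? N)

-- Parity and squares modulo 8

%2≡0⊎%2≡1 : ∀ a → a % 2 ≡ 0 ⊎ a % 2 ≡ 1
%2≡0⊎%2≡1 a with a % 2 | m%n<n a 2
... | 0           | _               = inj₁ refl
... | 1           | _               = inj₂ refl
... | suc (suc _) | s≤s (s≤s ())

parity-pigeonhole : ∀ a b c → a % 2 ≡ b % 2 ⊎ a % 2 ≡ c % 2 ⊎ b % 2 ≡ c % 2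
parity-pigeonhole a b c with %2≡0⊎%2≡1 a | %2≡0⊎%2≡1 b | %2≡0⊎%2≡1 c
... | inj₁ a₀ | inj₁ b₀ | _       = inj₁ (trans a₀ (sym b₀))
... | inj₂ a₁ | inj₂ b₁ | _       = inj₁ (trans a₁ (sym b₁))
... | inj₁ a₀ | inj₂ _  | inj₁ c₀ = inj₂ (inj₁ (trans a₀ (sym c₀)))
... | inj₂ a₁ | inj₁ _  | inj₂ c₁ = inj₂ (inj₁ (trans a₁ (sym c₁)))
... | inj₁ _  | inj₂ b₁ | inj₂ c₁ = inj₂ (inj₂ (trans b₁ (sym c₁)))
... | inj₂ _  | inj₁ b₀ | inj₁ c₀ = inj₂ (inj₂ (trans b₀ (sym c₀)))

x*x≈1⇒x^s≈x^[s%2] : ∀ {m x} → x * x ≈ 1 [mod m ] → ∀ s → x ^ s ≈ x ^ (s % 2) [mod m ]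
x*x≈1⇒x^s≈x^[s%2] x²≈1 zero = ≈-refl
x*x≈1⇒x^s≈x^[s%2] x²≈1 (suc zero) = ≈-refl
x*x≈1⇒x^s≈x^[s%2] {m} {x} x²≈1 (suc (suc s)) = begin
  x * (x * x ^ s)  ≡⟨ *-assoc x x (x ^ s) ⟨
  x * x * x ^ s    ≈⟨ ≈-* x²≈1 ≈-refl ⟩
  1 * x ^ s        ≡⟨ *-identityˡ (x ^ s) ⟩
  x ^ s            ≈⟨ x*x≈1⇒x^s≈x^[s%2] x²≈1 s ⟩
  x ^ (s % 2)      ∎
  where open ≈-Reasoning

odd⇒square≈1[mod8] : ∀ {q} → ¬ 2 ∣ q → q * q ≈ 1 [mod 8 ]
odd⇒square≈1[mod8] {q} q-odd = begin
  q * q              ≈⟨ ≈-* (%-≈ q) (%-≈ q) ⟨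
  q % 8 * (q % 8)    ≈⟨ odd-residue (q % 8) (m%n<n q 8) (q-odd ∘ ∣n∣m%n⇒∣m (divides 4 refl)) ⟩
  1                  ∎
  where
  open ≈-Reasoning
  odd-residue : ∀ r → r < 8 → ¬ 2 ∣ r → r * r ≈ 1 [mod 8 ]
  odd-residue 0 _ 0-odd = contradiction (2 ∣0) 0-odd
  odd-residue 1 _ _     = ≈-refl
  odd-residue 2 _ 2-odd = contradiction (divides 1 refl) 2-odd
  odd-residue 3 _ _     = congruent (ℤ.divides (+ 1) refl)
  odd-residue 4 _ 4-odd = contradiction (divides 2 refl) 4-odd
  odd-residue 5 _ _     = congruent (ℤ.divides (+ 3) refl)
  odd-residue 6 _ 6-odd = contradiction (divides 3 refl) 6-odd
  odd-residue 7 _ _     = congruent (ℤ.divides (+ 6) refl)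
  odd-residue (suc (suc (suc (suc (suc (suc (suc (suc r)))))))) 8+r<8 _ =
    contradiction 8+r<8 (m+n≮m 8 r)

-- Arithmetic progressions of units

negative-inverse : ∀ {p d} → Prime p → ¬ p ∣ d → ∃[ y ] 1 + y * d ≈ 0 [mod p ]
negative-inverse {p} {d} p-prime p∤d with coprime-Bézout (Coprime.sym (prime∤⇒coprime p-prime p∤d))
... | Bézout.-+ x y 1+xd≡yp = x , subst (_≈ 0 [mod p ]) (sym 1+xd≡yp) (*-≈0 y)
-- Here x * d ≈ 1, so x * (p - 1) is an inverse of -d.
... | Bézout.+- x y 1+yp≡xd = x * pred p , (begin
  1 + x * pred p * d    ≡⟨ cong suc (x*u*d≡u*[x*d] x (pred p) d) ⟩
  1 + pred p * (x * d)  ≈⟨ ≈-+ˡ 1 (≈-*ˡ (pred p) xd≈1) ⟩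
  1 + pred p * 1        ≡⟨ cong suc (*-identityʳ (pred p)) ⟩
  suc (pred p)          ≡⟨ suc-pred p ⟩
  p                     ≡⟨ *-identityˡ p ⟨
  1 * p                 ≈⟨ *-≈0 1 ⟩
  0                     ∎)
  where
  open ≈-Reasoning
  instance
    p≢0 : NonZero p
    p≢0 = prime⇒nonZero p-prime
  x*u*d≡u*[x*d] : ∀ x u d → x * u * d ≡ u * (x * d)
  x*u*d≡u*[x*d] = solve-∀
  xd≈1 : x * d ≈ 1 [mod p ]
  xd≈1 = subst (_≈ 1 [mod p ]) 1+yp≡xd (+-*-≈ 1 y)

linear-congruence-solvable : ∀ {p} v d → Prime p → ¬ p ∣ d → ∃[ k ] k < p × p ∣ v + k * d
linear-congruence-solvable {p} v d p-prime p∤d = k % p , m%n<n k p , ≈0⇒∣ (begin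
  v + k % p * d      ≈⟨ ≈-+ˡ v (≈-*ʳ d (%-≈ k)) ⟩
  v + v * y * d      ≡⟨ v+v*y*d≡v*[1+y*d] v y d ⟩
  v * (1 + y * d)    ≈⟨ ≈-*ˡ v 1+yd≈0 ⟩
  v * 0              ≡⟨ *-zeroʳ v ⟩
  0                  ∎)
  where
  open ≈-Reasoning
  instance
    p≢0 : NonZero p
    p≢0 = prime⇒nonZero p-prime
  v+v*y*d≡v*[1+y*d] : ∀ v y d → v + v * y * d ≡ v * (1 + y * d)
  v+v*y*d≡v*[1+y*d] = solve-∀
  y : ℕ
  y = proj₁ (negative-inverse p-prime p∤d)
  1+yd≈0 : 1 + y * d ≈ 0 [mod p ]
  1+yd≈0 = proj₂ (negative-inverse p-prime p∤d)
  k : ℕ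
  k = v * y

rad-∣-common-difference : ∀ {N d τ v} .{{_ : NonZero τ}} → N ≡ d * τ →
  (∀ {k} → k < τ → Coprime N (v + k * d)) → rad N ∣ d
rad-∣-common-difference {N} {d} {τ} {v} N≡dτ units = rad-∣ prime∣d
  where
  prime∣d : ∀ {p} → Prime p → p ∣ N → p ∣ d
  prime∣d {p} p-prime p∣N with p ∣? d
  ... | yes p∣d = p∣d
  ... | no p∤d with euclidsLemma d τ p-prime (subst (p ∣_) N≡dτ p∣N)
  ...   | inj₁ p∣d = p∣d
  ...   | inj₂ p∣τ =
    let k , k<p , p∣v+kd = linear-congruence-solvable v d p-prime p∤d in
    contradiction (subst Prime (units (<-≤-trans k<p (∣⇒≤ p∣τ)) (p∣N , p∣v+kd)) p-prime) ¬prime[1]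

≈-progression⇒∣ : ∀ {m} v d i t → v + i * d ≈ v + (i + t) * d [mod m ] → m ∣ t * d
≈-progression⇒∣ {m} v d i t vid≈vitd =
  +-≈⇒∣ (≈-sym (subst (v + i * d ≈_[mod m ]) (v+[i+t]*d≡v+i*d+t*d v i t d) vid≈vitd))
  where
  v+[i+t]*d≡v+i*d+t*d : ∀ v i t d → v + (i + t) * d ≡ v + i * d + t * d
  v+[i+t]*d≡v+i*d+t*d = solve-∀

4∣common-difference : ∀ {d τ q} u v .{{_ : NonZero τ}} → ¬ 2 ∣ q → 8 ∣ d * τ →
  (∀ {k} → k < τ → ∃[ a ] u * q ^ a ≈ v + k * d [mod 8 ]) → 4 ∣ d
4∣common-difference {d} {1} _ _ _ 8∣d*1 _ =
  ∣-trans (divides 2 refl) (subst (8 ∣_) (*-identityʳ d) 8∣d*1)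
4∣common-difference {d} {2} _ _ _ 8∣d*2 _ = *-cancelʳ-∣ 2 8∣d*2
4∣common-difference {d} {suc (suc (suc _))} {q} u v q-odd _ terms =
  pigeonhole (terms {0} z<s) (terms {1} (s<s z<s)) (terms {2} (s<s (s<s z<s)))
  where
  8∣1*d⇒4∣d : 8 ∣ 1 * d → 4 ∣ d
  8∣1*d⇒4∣d 8∣1*d = ∣-trans (divides 2 refl) (subst (8 ∣_) (*-identityˡ d) 8∣1*d)

  Term : ℕ → Set
  Term k = ∃[ a ] u * q ^ a ≈ v + k * d [mod 8 ]

  same-parity : ∀ i j → ((a , _) : Term i) → ((b , _) : Term j) → a % 2 ≡ b % 2 →
    v + i * d ≈ v + j * d [mod 8 ]
  same-parity i j (a , uq^a≈) (b , uq^b≈) a≡b = begin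
    v + i * d          ≈⟨ uq^a≈ ⟨
    u * q ^ a          ≈⟨ ≈-*ˡ u (x*x≈1⇒x^s≈x^[s%2] (odd⇒square≈1[mod8] q-odd) a) ⟩
    u * q ^ (a % 2)    ≡⟨ cong (λ r → u * q ^ r) a≡b ⟩
    u * q ^ (b % 2)    ≈⟨ ≈-*ˡ u (x*x≈1⇒x^s≈x^[s%2] (odd⇒square≈1[mod8] q-odd) b) ⟨
    u * q ^ b          ≈⟨ uq^b≈ ⟩
    v + j * d          ∎
    where open ≈-Reasoning

  pigeonhole : Term 0 → Term 1 → Term 2 → 4 ∣ d
  pigeonhole t₀@(a₀ , _) t₁@(a₁ , _) t₂@(a₂ , _) with parity-pigeonhole a₀ a₁ a₂
  ... | inj₁ a₀≡a₁        = 8∣1*d⇒4∣d (≈-progression⇒∣ v d 0 1 (same-parity 0 1 t₀ t₁ a₀≡a₁))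
  ... | inj₂ (inj₁ a₀≡a₂) = *-cancelˡ-∣ 2 (≈-progression⇒∣ v d 0 2 (same-parity 0 2 t₀ t₂ a₀≡a₂))
  ... | inj₂ (inj₂ a₁≡a₂) = 8∣1*d⇒4∣d (≈-progression⇒∣ v d 1 1 (same-parity 1 2 t₁ t₂ a₁≡a₂))

-- Multiplicative orders

^-divMod : ∀ x a w .{{_ : NonZero w}} → x ^ a ≡ x ^ (a % w) * (x ^ w) ^ (a / w)
^-divMod x a w = begin
  x ^ a                            ≡⟨ cong (x ^_) (m≡m%n+[m/n]*n a w) ⟩
  x ^ (a % w + a / w * w)          ≡⟨ ^-distribˡ-+-* x (a % w) (a / w * w) ⟩
  x ^ (a % w) * x ^ (a / w * w)    ≡⟨ cong (λ e → x ^ (a % w) * x ^ e) (*-comm (a / w) w) ⟩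
  x ^ (a % w) * x ^ (w * (a / w))  ≡⟨ cong (x ^ (a % w) *_) (^-*-assoc x w (a / w)) ⟨
  x ^ (a % w) * (x ^ w) ^ (a / w)  ∎
  where open ≡-Reasoning

order-∣ : ∀ {m q o c} → IsOrder m q o → q ^ c ≈ 1 [mod m ] → o ∣ c
order-∣ {m} {q} {o} {c} (0<o , q^o≡1 , minimal) q^c≈1 = m%n≡0⇒n∣m c o c%o≡0
  where
  instance
    o≢0 : NonZero o
    o≢0 = >-nonZero 0<o
  q^[c%o]≈1 : q ^ (c % o) ≈ 1 [mod m ]
  q^[c%o]≈1 = begin
    q ^ (c % o)                      ≡⟨ *-identityʳ (q ^ (c % o)) ⟨
    q ^ (c % o) * 1                  ≡⟨ cong (q ^ (c % o) *_) (^-zeroˡ (c / o)) ⟨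
    q ^ (c % o) * 1 ^ (c / o)        ≈⟨ ≈-*ˡ (q ^ (c % o)) (≈-^ (c / o) (≡[mod]⇒≈ q^o≡1)) ⟨
    q ^ (c % o) * (q ^ o) ^ (c / o)  ≡⟨ ^-divMod q c o ⟨
    q ^ c                            ≈⟨ q^c≈1 ⟩
    1                                ∎
    where open ≈-Reasoning
  c%o≡0 : c % o ≡ 0
  c%o≡0 with c % o ≟ 0
  ... | yes c%o≡0 = c%o≡0
  ... | no c%o≢0 = contradiction (≈⇒≡[mod] q^[c%o]≈1) (minimal (c % o) (n≢0⇒n>0 c%o≢0) (m%n<n c o))

2*order-∣ : ∀ {m q o c} → q ^ o % 4 ≡ 3 → 4 ∣ m → o ∣ c → q ^ c ≈ 1 [mod m ] → 2 * o ∣ c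
2*order-∣ {m} {q} {o} q^o%4≡3 4∣m (divides s refl) q^so≈1 with %2≡0⊎%2≡1 s
... | inj₁ s%2≡0 = *-monoˡ-∣ o (m%n≡0⇒n∣m s 2 s%2≡0)
... | inj₂ s%2≡1 = contradiction (+-≈⇒∣ (≈-sym 1≈3)) (from-no (4 ∣? 2))
  where
  open ≈-Reasoning
  Q : ℕ
  Q = q ^ o
  Q≈3 : Q ≈ 3 [mod 4 ]
  Q≈3 = ≈-sym (subst (_≈ Q [mod 4 ]) q^o%4≡3 (%-≈ Q))
  Q*Q≈1 : Q * Q ≈ 1 [mod 4 ]
  Q*Q≈1 = ≈-trans (≈-* Q≈3 Q≈3) (congruent (ℤ.divides (+ 2) refl))
  1≈3 : 1 ≈ 3 [mod 4 ]
  1≈3 = begin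
    1                 ≈⟨ ≈-mod-∣ 4∣m q^so≈1 ⟨
    q ^ (s * o)       ≡⟨ cong (q ^_) (*-comm s o) ⟩
    q ^ (o * s)       ≡⟨ ^-*-assoc q o s ⟨
    Q ^ s             ≈⟨ x*x≈1⇒x^s≈x^[s%2] Q*Q≈1 s ⟩
    Q ^ (s % 2)       ≡⟨ cong (Q ^_) s%2≡1 ⟩
    Q * 1             ≡⟨ *-identityʳ Q ⟩
    Q                 ≈⟨ Q≈3 ⟩
    3                 ∎

omega-cases : ∀ q o N → omega q o N ≡ o ⊎ (omega q o N ≡ 2 * o × q ^ o % 4 ≡ 3 × 8 ∣ N)
omega-cases q o N = by-cases ((q ^ o % 4) ≟ 3) (8 ∣? N)
  where
  by-cases : (q^o≡3? : Dec (q ^ o % 4 ≡ 3)) (8∣N? : Dec (8 ∣ N)) →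
    let ω = if does q^o≡3? ∧ does 8∣N? then 2 * o else o in
    ω ≡ o ⊎ (ω ≡ 2 * o × q ^ o % 4 ≡ 3 × 8 ∣ N)
  by-cases (yes q^o≡3) (yes 8∣N) = inj₂ (refl , q^o≡3 , 8∣N)
  by-cases (yes _)     (no _)    = inj₁ refl
  by-cases (no _)      _         = inj₁ refl

omega-nonZero : ∀ q o N → 0 < o → NonZero (omega q o N)
omega-nonZero q o N 0<o with omega-cases q o N
... | inj₁ ω≡o           = subst NonZero (sym ω≡o) (>-nonZero 0<o)
... | inj₂ (ω≡2*o , _ ) = subst NonZero (sym ω≡2*o) (m*n≢0 2 o {{_}} {{>-nonZero 0<o}})

omega-∣ : ∀ {N m q o c} → IsOrder (rad N) q o → rad N ∣ m → (8 ∣ N → 4 ∣ m) →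
  q ^ c ≈ 1 [mod m ] → omega q o N ∣ c
omega-∣ {N} {m} {q} {o} {c} ord rad∣m 8∣N⇒4∣m q^c≈1 with omega-cases q o N
... | inj₁ ω≡o = subst (_∣ c) (sym ω≡o) (order-∣ ord (≈-mod-∣ rad∣m q^c≈1))
... | inj₂ (ω≡2*o , q^o%4≡3 , 8∣N) = subst (_∣ c) (sym ω≡2*o)
  (2*order-∣ q^o%4≡3 (8∣N⇒4∣m 8∣N) (order-∣ ord (≈-mod-∣ rad∣m q^c≈1)) q^c≈1)

exponent-shift-∣ : ∀ {m q u w a c} → Coprime m q → Coprime m u →
  (∀ {c} → q ^ c ≈ 1 [mod m ] → w ∣ c) → u * q ^ a ≈ u * q ^ (a + c) [mod m ] → w ∣ c
exponent-shift-∣ {m} {q} {u} {w} {a} {c} m⊥q m⊥u q^c≈1⇒w∣c uq^a≈uq^[a+c] =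
  q^c≈1⇒w∣c (≈-sym (coprime-cancelˡ-≈ (coprime-*ʳ m⊥u (coprime-^ʳ a m⊥q)) (begin
    u * q ^ a * 1          ≡⟨ *-identityʳ (u * q ^ a) ⟩
    u * q ^ a              ≈⟨ uq^a≈uq^[a+c] ⟩
    u * q ^ (a + c)        ≡⟨ cong (u *_) (^-distribˡ-+-* q a c) ⟩
    u * (q ^ a * q ^ c)    ≡⟨ *-assoc u (q ^ a) (q ^ c) ⟨
    u * q ^ a * q ^ c      ∎)))
  where open ≈-Reasoning

≈⇒exponents-≡ : ∀ {m q u w a b} .{{_ : NonZero w}} → Coprime m q → Coprime m u →
  (∀ {c} → q ^ c ≈ 1 [mod m ] → w ∣ c) → u * q ^ a ≈ u * q ^ b [mod m ] → a % w ≡ b % w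
≈⇒exponents-≡ {a = a} {b} m⊥q m⊥u q^c≈1⇒w∣c uq^a≈uq^b with ≤-total a b
... | inj₁ a≤b with c , refl ← m≤n⇒∃[o]m+o≡n a≤b =
  sym (%-remove-+ʳ a (exponent-shift-∣ {a = a} m⊥q m⊥u q^c≈1⇒w∣c uq^a≈uq^b))
... | inj₂ b≤a with c , refl ← m≤n⇒∃[o]m+o≡n b≤a =
  %-remove-+ʳ b (exponent-shift-∣ {a = b} m⊥q m⊥u q^c≈1⇒w∣c (≈-sym uq^a≈uq^b))

-- Cosets

inCoset-^ : ∀ {n x} β N a w .{{_ : NonZero w}} → toℕ x ≡ β * N ^ a [mod n ] →
  InCoset n (N ^ w) (β * N ^ (a % w)) x
inCoset-^ {n} {x} β N a w x≡βN^a = a / w , subst (λ y → toℕ x ≡ y [mod n ]) βN^a≡ x≡βN^a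
  where
  βN^a≡ : β * N ^ a ≡ β * N ^ (a % w) * (N ^ w) ^ (a / w)
  βN^a≡ = trans (cong (β *_) (^-divMod N a w)) (sym (*-assoc β (N ^ (a % w)) ((N ^ w) ^ (a / w))))

module ProgressionInOrbit
  (q n γ b d τ : ℕ) .{{_ : NonZero n}} (n≡dτ : n ≡ d * τ) (n⊥q : Coprime n q)
  (inOrbit : ∀ {k} → k < τ → ∃[ a ] γ * q ^ a ≈ γ * q ^ b + k * d [mod n ])
  where

  g : ℕ
  g = gcd γ n

  N : ℕ
  N = nγ n γ

  γ′ : ℕ
  γ′ = quotient (gcd[m,n]∣m γ n)

  n≡Ng : n ≡ N * g
  n≡Ng = m∣n⇒n≡quotient*m (gcd[m,n]∣n γ n)

  γ≡γ′g : γ ≡ γ′ * g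
  γ≡γ′g = m∣n⇒n≡quotient*m (gcd[m,n]∣m γ n)

  instance
    g≢0 : NonZero g
    g≢0 = ≢-nonZero (λ g≡0 → ≢-nonZero⁻¹ n (trans n≡Ng (trans (cong (N *_) g≡0) (*-zeroʳ N))))

    τ≢0 : NonZero τ
    τ≢0 = ≢-nonZero (λ τ≡0 → ≢-nonZero⁻¹ n (trans n≡dτ (trans (cong (d *_) τ≡0) (*-zeroʳ d))))

  g∣d : g ∣ d
  g∣d with 1 <? τ
  ... | yes 1<τ = let a , γq^a≈γq^b+d = inOrbit 1<τ in
    subst (g ∣_) (*-identityˡ d) (∣m+n∣m⇒∣n
      (∣-resp-≈ (gcd[m,n]∣n γ n) γq^a≈γq^b+d (∣m⇒∣m*n (q ^ a) (gcd[m,n]∣m γ n)))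
      (∣m⇒∣m*n (q ^ b) (gcd[m,n]∣m γ n)))
  ... | no 1≮τ = subst (g ∣_) n≡d (gcd[m,n]∣n γ n)
    where
    n≡d : n ≡ d
    n≡d = trans n≡dτ (trans (cong (d *_) (≤-antisym (≮⇒≥ 1≮τ) (>-nonZero⁻¹ τ))) (*-identityʳ d))

  d′ : ℕ
  d′ = quotient g∣d

  d≡d′g : d ≡ d′ * g
  d≡d′g = m∣n⇒n≡quotient*m g∣d

  N≡d′τ : N ≡ d′ * τ
  N≡d′τ = *-cancelʳ-≡ N (d′ * τ) g (begin
    N * g       ≡⟨ n≡Ng ⟨
    n           ≡⟨ n≡dτ ⟩
    d * τ       ≡⟨ cong (_* τ) d≡d′g ⟩
    d′ * g * τ  ≡⟨ x*y*z≡x*z*y d′ g τ ⟩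
    d′ * τ * g  ∎)
    where
    open ≡-Reasoning
    x*y*z≡x*z*y : ∀ x y z → x * y * z ≡ x * z * y
    x*y*z≡x*z*y = solve-∀

  d′∣N : d′ ∣ N
  d′∣N = divides τ (trans N≡d′τ (*-comm d′ τ))

  N⊥γ′ : Coprime N γ′
  N⊥γ′ = Coprime.sym (subst₂ Coprime
    (n/m≡quotient (gcd[m,n]∣m γ n)) (n/m≡quotient (gcd[m,n]∣n γ n)) (coprime-/gcd γ n))

  N⊥q : Coprime N q
  N⊥q = coprime-∣ˡ (quotient-∣ (gcd[m,n]∣n γ n)) n⊥q

  divide-by-g : ∀ a k → γ * q ^ a ≈ γ * q ^ b + k * d [mod n ] →
    γ′ * q ^ a ≈ γ′ * q ^ b + k * d′ [mod N ]
  divide-by-g a k γq^a≈γq^b+kd = *-cancelʳ-≈ (subst₂ (_≈_[mod N * g ]) γq^a≡ γq^b+kd≡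
    (subst (γ * q ^ a ≈ γ * q ^ b + k * d [mod_]) n≡Ng γq^a≈γq^b+kd))
    where
    c*g*x≡c*x*g : ∀ c g x → c * g * x ≡ c * x * g
    c*g*x≡c*x*g = solve-∀
    c*g*y+k*[e*g]≡[c*y+k*e]*g : ∀ c g y k e → c * g * y + k * (e * g) ≡ (c * y + k * e) * g
    c*g*y+k*[e*g]≡[c*y+k*e]*g = solve-∀
    γq^a≡ : γ * q ^ a ≡ γ′ * q ^ a * g
    γq^a≡ = trans (cong (_* q ^ a) γ≡γ′g) (c*g*x≡c*x*g γ′ g (q ^ a))
    γq^b+kd≡ : γ * q ^ b + k * d ≡ (γ′ * q ^ b + k * d′) * g
    γq^b+kd≡ = trans (cong₂ (λ c e → c * q ^ b + k * e) γ≡γ′g d≡d′g)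
                     (c*g*y+k*[e*g]≡[c*y+k*e]*g γ′ g (q ^ b) k d′)

  rad-N∣d′ : rad N ∣ d′
  rad-N∣d′ = rad-∣-common-difference N≡d′τ unit
    where
    unit : ∀ {k} → k < τ → Coprime N (γ′ * q ^ b + k * d′)
    unit {k} k<τ = let a , γq^a≈ = inOrbit k<τ in
      coprime-resp-≈ (divide-by-g a k γq^a≈) (coprime-*ʳ N⊥γ′ (coprime-^ʳ a N⊥q))

  8∣N⇒4∣d′ : 8 ∣ N → 4 ∣ d′
  8∣N⇒4∣d′ 8∣N = 4∣common-difference γ′ (γ′ * q ^ b) q-odd (subst (8 ∣_) N≡d′τ 8∣N)
    (λ {k} k<τ → let a , γq^a≈ = inOrbit k<τ in a , ≈-mod-∣ 8∣N (divide-by-g a k γq^a≈))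
    where
    q-odd : ¬ 2 ∣ q
    q-odd 2∣q with N⊥q (∣-trans (divides 4 refl) 8∣N , 2∣q)
    ... | ()

  exponent-≡ : ∀ {o} a k → IsOrder (rad N) q o → .{{_ : NonZero (omega q o N)}} →
    γ * q ^ a ≈ γ * q ^ b + k * d [mod n ] → a % omega q o N ≡ b % omega q o N
  exponent-≡ a k ord γq^a≈γq^b+kd = ≈⇒exponents-≡
    (coprime-∣ˡ d′∣N N⊥q) (coprime-∣ˡ d′∣N N⊥γ′)
    (omega-∣ ord rad-N∣d′ 8∣N⇒4∣d′)
    (≈-trans (≈-mod-∣ d′∣N (divide-by-g a k γq^a≈γq^b+kd)) (+-*-≈ (γ′ * q ^ b) k))

corollary4p1 : (q n : ℕ) → .{{_ : NonZero n}} → IsPrimePower q → Coprime n q →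
    (γ : Fin n) → (o : ℕ) → IsOrder (rad (nγ n (toℕ γ))) q o →
    (E : Subset n) → SubsetOfCoset n q (toℕ γ) E → EqualDifference n E →
    ∃[ j ] (j < omega q o (nγ n (toℕ γ)) ×
      SubsetOfCoset n (q ^ omega q o (nγ n (toℕ γ))) (toℕ γ * q ^ j) E)
-- q need not be a prime power: only Coprime n q is used.
corollary4p1 q n _ n⊥q γ o ord E E⊆c (d , n≡dτ , e , e∈E , E≡progression) with E⊆c e e∈E
... | b , e≡γq^b = b % ω , m%n<n b ω , E⊆c′
  where
  term : ∀ x k a → toℕ x ≡ toℕ e + k * d [mod n ] → toℕ x ≡ toℕ γ * q ^ a [mod n ] →
    toℕ γ * q ^ a ≈ toℕ γ * q ^ b + k * d [mod n ]
  term x k a x≡e+kd x≡γq^a = begin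
    toℕ γ * q ^ a      ≈⟨ ≡[mod]⇒≈ x≡γq^a ⟨
    toℕ x              ≈⟨ ≡[mod]⇒≈ x≡e+kd ⟩
    toℕ e + k * d      ≈⟨ ≈-+ʳ (k * d) (≡[mod]⇒≈ e≡γq^b) ⟩
    toℕ γ * q ^ b + k * d ∎
    where open ≈-Reasoning

  inOrbit : ∀ {k} → k < ∣ E ∣ → ∃[ a ] toℕ γ * q ^ a ≈ toℕ γ * q ^ b + k * d [mod n ]
  inOrbit {k} k<τ = let a , x≡γq^a = E⊆c x (proj₂ (E≡progression x) (k , k<τ , x≡e+kd)) in
    a , term x k a x≡e+kd x≡γq^a
    where
    x : Fin n
    x = fromℕ< (m%n<n (toℕ e + k * d) n)
    x≡e+kd : toℕ x ≡ toℕ e + k * d [mod n ]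
    x≡e+kd = ≈⇒≡[mod] (subst (_≈ toℕ e + k * d [mod n ]) (sym (toℕ-fromℕ< _)) (%-≈ _))

  open ProgressionInOrbit q n (toℕ γ) b d ∣ E ∣ n≡dτ n⊥q inOrbit using (N; exponent-≡)

  ω : ℕ
  ω = omega q o N

  instance
    ω≢0 : NonZero ω
    ω≢0 = omega-nonZero q o N (proj₁ ord)

  E⊆c′ : SubsetOfCoset n (q ^ ω) (toℕ γ * q ^ (b % ω)) E
  E⊆c′ x x∈E with proj₁ (E≡progression x) x∈E | E⊆c x x∈E
  ... | k , _ , x≡e+kd | a , x≡γq^a = subst (λ r → InCoset n (q ^ ω) (toℕ γ * q ^ r) x)
    (exponent-≡ a k ord (term x k a x≡e+kd x≡γq^a)) (inCoset-^ (toℕ γ) q a ω x≡γq^a)
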